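{- Let $n\ge1$. If $((\ell_1,u_1),(\ell_2,u_2),\dots,(\ell_n,u_n))$ is the label sequence of a falling maximal chain of $\mathcal{P}_n$, then $((n+1-\ell_n,n+1-u_n),\dots,(n+1-\ell_1,n+1-u_1))$ is also the label sequence of a falling maximal chain of $\mathcal{P}_n$.
   Context: Identify a monotone lattice path from $(0,0)$ to $(n-k,k)$ with the $k$-subset of $[n]$ of positions of its North steps. For $k$-subsets $U=\{u_1<\dots<u_k\}$, $L=\{\ell_1<\dots<\ell_k\}$ of $[n]$ with $u_i\le\ell_i$ for all $i$, the lattice path matroid $M[U,L]$ is the matroid on $[n]$ whose bases are the $k$-sets $\{b_1<\dots<b_k\}$ with $u_i\le b_i\le\ell_i$. $\mathcal{P}_n$ is the poset of all lattice path matroids on $[n]$ ordered by the matroid quotient relation ($M'\le_q M$ iff there is a matroid $N$ on $[n]\sqcup T$ with $M=N\setminus T$, $M'=N/T$). Known: $M[U',L']\le_q M[U,L]$ iff $U'\subseteq U$, $L'\subseteq L$ and the greedy pairing is good, where: $(\ell_i,u_j)$ is a good pair of $M[U,L]$ if $i\le j$ and $u_j-\ell_i\le j-i$; with $U\setminus U'=\{a_1<\dots<a_z\}$, $L\setminus L'=\{b_1<\dots<b_z\}$, the greedy pairing $((b_1,a_1),\dots,(b_z,a_z))$ is good if each $(b_r,a_r)$ is a good pair of $M[U\setminus\{a_1,\dots,a_{r-1}\},L\setminus\{b_1,\dots,b_{r-1}\}]$. Covers are $M[U\setminus\{u\},L\setminus\{\ell\}]\lessdot M[U,L]$, labeled $(\ell,u)$.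 A maximal chain $U_{0,n}=M_0\lessdot M_1\lessdot\cdots\lessdot M_n=U_{n,n}$ (with $U_{0,n}=M[\emptyset,\emptyset]$, $U_{n,n}=M[[n],[n]]$) has label sequence $((\ell_1,u_1),\dots,(\ell_n,u_n))$ where $(\ell_i,u_i)$ labels $M_{i-1}\lessdot M_i$. It is falling if for each $1\le i<n$ it is not the case that $\ell_i<\ell_{i+1}$ and $u_i<u_{i+1}$. -}

module Defs where

open import Data.Nat using (ℕ; zero; suc; _+_; _∸_; _≤_; _<_)
open import Data.Nat.Properties using (_≟_)
open import Data.Product using (Σ; Σ-syntax; _×_; _,_)
open import Data.List using (List; []; _∷_; map; reverse; upTo)
open import Data.List.Relation.Unary.All using (All)
open import Data.List.Relation.Unary.Linked using (Linked)
open import Data.List.Relation.Binary.Pointwise using (Pointwise)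
open import Relation.Binary.PropositionalEquality using (_≡_)
open import Relation.Nullary using (¬_; yes; no)

-- A k-subset of [n] = {1,…,n} is represented by the strictly increasing
-- list of its elements (so the i-th list entry is the i-th smallest element).

InRange : ℕ → ℕ → Set
InRange n x = 1 ≤ x × x ≤ n

range : ℕ → List ℕ
range n = map suc (upTo n)

-- The lattice path matroid M[U,L] on [n]: U, L are k-subsets of [n]
-- (increasing lists) with u_i ≤ ℓ_i for all i.  M[U,L] is determined by
-- (and determines) the pair (U,L) (U = lex-smallest, L = lex-largest basis).
record LPM (n : ℕ) : Set where
  field
    U        : List ℕ
    L        : List ℕ
    U-sorted : Linked _<_ U
    L-sorted : Linked _<_ L
    U-range  : All (InRange n) U
    L-range  : All (InRange n) L
    U≤L      : Pointwise _≤_ U L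
open LPM public

data IsAt : List ℕ → ℕ → ℕ → Set where
  here  : ∀ {x xs} → IsAt (x ∷ xs) zero x
  there : ∀ {y xs i x} → IsAt xs i x → IsAt (y ∷ xs) (suc i) x

-- (ℓ , u) is a good pair of M[U,L]: ℓ = ℓ_i, u = u_j, i ≤ j and
-- u_j - ℓ_i ≤ j - i  (written u + i ≤ ℓ + j to stay in ℕ).
GoodPair : List ℕ → List ℕ → ℕ → ℕ → Set
GoodPair U L ℓ u =
  Σ[ i ∈ ℕ ] Σ[ j ∈ ℕ ]
    (IsAt L i ℓ × IsAt U j u × i ≤ j × u + i ≤ ℓ + j)

delete : ℕ → List ℕ → List ℕ
delete x [] = []
delete x (y ∷ ys) with x ≟ y
... | yes _ = ys
... | no  _ = y ∷ delete x ys

Label : Set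
Label = ℕ × ℕ

-- Cover relation of 𝒫_n:  M' ⋖ M with label (ℓ , u), i.e.
-- M' = M[U∖{u}, L∖{ℓ}] ⋖ M = M[U,L], where (ℓ,u) is a good pair of M[U,L]
-- (the greedy-pairing quotient criterion with |U∖U'| = 1).
Cover : ∀ {n} → LPM n → LPM n → Label → Set
Cover M' M (ℓ , u) =
  GoodPair (U M) (L M) ℓ u ×
  U M' ≡ delete u (U M) × L M' ≡ delete ℓ (L M)

ChainToTop : ∀ n → LPM n → List Label → Set
ChainToTop n M []           = U M ≡ range n × L M ≡ range n
ChainToTop n M (lab ∷ labs) = Σ[ M' ∈ LPM n ] (Cover M M' lab × ChainToTop n M' labs)

-- labs is the label sequence of a maximal chain U_{0,n} = M_0 ⋖ ⋯ ⋖ U_{n,n} of 𝒫_n.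
IsMaxChainLabels : ℕ → List Label → Set
IsMaxChainLabels n labs =
  Σ[ M₀ ∈ LPM n ] (U M₀ ≡ [] × L M₀ ≡ [] × ChainToTop n M₀ labs)

NotAscent : Label → Label → Set
NotAscent (ℓ , u) (ℓ' , u') = ¬ (ℓ < ℓ' × u < u')

Falling : List Label → Set
Falling = Linked NotAscent

IsFallingMaxChainLabels : ℕ → List Label → Set
IsFallingMaxChainLabels n labs = IsMaxChainLabels n labs × Falling labs

flipLabel : ℕ → Label → Label
flipLabel n (ℓ , u) = (suc n ∸ ℓ , suc n ∸ u)

reflect : ℕ → List Label → List Label
reflect n labs = reverse (map (flipLabel n) labs)

{-# OPTIONS --safe #-}
-- The reversed dual sends M[U,L] to M[U*,L*] with A* = {y ∈ [n] : n+1−y ∉ A}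
-- (bases B ↦ {n+1−b : b ∉ B}) and reverses quotients: a cover labelled (ℓ,u)
-- becomes the opposite cover labelled (n+1−ℓ, n+1−u).  Counting elements below t,
-- #{y ∈ A* : y ≤ t} + |A| = t + #{a ∈ A : a ≤ n−t}, so if ℓ = ℓ_i and u = u_j then
-- n+1−ℓ and n+1−u sit at positions i*, j* of the dual with i* + k = (n+1−ℓ) + i and
-- j* + k = (n+1−u) + j, k the rank; these relations exchange the two good-pair
-- conditions i ≤ j and u_j − ℓ_i ≤ j − i.  As U_{0,n}* = U_{n,n}, a maximal chain is
-- carried to a maximal chain with the reflected labels, and flipping both coordinates
-- of the labels reverses each comparison, so falling chains stay falling.
module Submission where

open import Defs
open import Data.Nat using (ℕ; zero; suc; _+_; _∸_; _≤_; _<_; z≤n; s≤s; s≤s⁻¹; _≤?_)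
open import Data.Nat.Properties
open import Algebra.Properties.CommutativeSemigroup +-commutativeSemigroup
  using (interchange; x∙yz≈y∙xz)
open import Data.List using (List; []; _∷_; map; reverse; reverseAcc; filter; length; _∷ʳ_)
open import Data.List.Membership.DecPropositional _≟_ using (_∈?_)
open import Data.List.Membership.Propositional using (_∈_; _∉_)
open import Data.List.Membership.Propositional.Properties
  using (∈-filter⁺; ∈-filter⁻; ∈-map⁺; ∈-map⁻; ∈-upTo⁺; ∈-upTo⁻)
open import Data.List.Properties using (unfold-reverse; filter-all; filter-none)
open import Data.List.Relation.Binary.Pointwise using (Pointwise; []; _∷_; Pointwise-length)
import Data.List.Relation.Binary.Pointwise as Pointwise
open import Data.List.Relation.Unary.All using (All; []; _∷_)
import Data.List.Relation.Unary.All as All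
open import Data.List.Relation.Unary.AllPairs using (_∷_)
open import Data.List.Relation.Unary.Any using (here; there)
open import Data.List.Relation.Unary.Linked using (Linked; []; [-]; _∷_)
import Data.List.Relation.Unary.Linked as Linked
open import Data.List.Relation.Unary.Linked.Properties
  using (Linked⇒AllPairs; AllPairs⇒Linked; map⁺; filter⁺; applyUpTo⁺₂)
open import Data.Product using (Σ-syntax; ∃; _×_; _,_; proj₁; proj₂)
open import Data.Sum using (inj₁; inj₂)
open import Function using (_∘_; flip)
open import Relation.Binary.PropositionalEquality
open import Relation.Nullary using (Dec; yes; no; ¬?; contradiction)
open import Relation.Unary using (Decidable)

Sorted : List ℕ → Set
Sorted = Linked _<_

head<tail : ∀ {x xs} → Sorted (x ∷ xs) → All (x <_) xs
head<tail s with Linked⇒AllPairs <-trans s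
... | x<xs ∷ _ = x<xs

sorted-∷ : ∀ {x xs} → All (x <_) xs → Sorted xs → Sorted (x ∷ xs)
sorted-∷ x<xs s = AllPairs⇒Linked (x<xs ∷ Linked⇒AllPairs <-trans s)

∈-tail : ∀ {x y ys} → x ∈ y ∷ ys → y < x → x ∈ ys
∈-tail (here refl) y<x = contradiction y<x (<-irrefl refl)
∈-tail (there x∈ys) _  = x∈ys

sorted-ext : ∀ {A B} → Sorted A → Sorted B →
             (∀ {x} → x ∈ A → x ∈ B) → (∀ {x} → x ∈ B → x ∈ A) → A ≡ B
sorted-ext {[]}    {[]}    _  _  _   _   = refl
sorted-ext {[]}    {b ∷ B} _  _  _   B⊆A with () ← B⊆A (here refl)
sorted-ext {a ∷ A} {[]}    _  _  A⊆B _   with () ← A⊆B (here refl)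
sorted-ext {a ∷ A} {b ∷ B} sA sB A⊆B B⊆A =
  cong₂ _∷_ a≡b (sorted-ext (Linked.tail sA) (Linked.tail sB) A′⊆B′ B′⊆A′)
  where
  a≡b : a ≡ b
  a≡b with A⊆B (here refl) | B⊆A (here refl)
  ... | here a≡b | _        = a≡b
  ... | _        | here b≡a = sym b≡a
  ... | there a∈B | there b∈A =
    contradiction (All.lookup (head<tail sB) a∈B) (<-asym (All.lookup (head<tail sA) b∈A))
  A′⊆B′ : ∀ {x} → x ∈ A → x ∈ B
  A′⊆B′ x∈A = ∈-tail (A⊆B (there x∈A)) (subst (_< _) a≡b (All.lookup (head<tail sA) x∈A))
  B′⊆A′ : ∀ {x} → x ∈ B → x ∈ A
  B′⊆A′ x∈B = ∈-tail (B⊆A (there x∈B)) (subst (_< _) (sym a≡b) (All.lookup (head<tail sB) x∈B))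

All-delete : ∀ {P : ℕ → Set} x A → All P A → All P (delete x A)
All-delete x []      []         = []
All-delete x (y ∷ A) (py ∷ pA) with x ≟ y
... | yes _ = pA
... | no  _ = py ∷ All-delete x A pA

delete-sorted : ∀ x A → Sorted A → Sorted (delete x A)
delete-sorted x []      _ = []
delete-sorted x (y ∷ A) s with x ≟ y
... | yes _ = Linked.tail s
... | no  _ = sorted-∷ (All-delete x A (head<tail s)) (delete-sorted x A (Linked.tail s))

∈-delete⁻ : ∀ {y} x A → y ∈ delete x A → y ∈ A
∈-delete⁻ x (z ∷ A) y∈ with x ≟ z
∈-delete⁻ x (z ∷ A) y∈          | yes _ = there y∈
∈-delete⁻ x (z ∷ A) (here y≡z)  | no  _ = here y≡z
∈-delete⁻ x (z ∷ A) (there y∈)  | no  _ = there (∈-delete⁻ x A y∈)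

∈-delete⁺ : ∀ {y} x A → y ∈ A → y ≢ x → y ∈ delete x A
∈-delete⁺ x (z ∷ A) y∈ y≢x with x ≟ z
∈-delete⁺ x (z ∷ A) (here refl) y≢x | yes refl = contradiction refl y≢x
∈-delete⁺ x (z ∷ A) (there y∈)  _   | yes _    = y∈
∈-delete⁺ x (z ∷ A) (here y≡z)  _   | no  _    = here y≡z
∈-delete⁺ x (z ∷ A) (there y∈)  y≢x | no  _    = there (∈-delete⁺ x A y∈ y≢x)

∉-delete : ∀ x A → Sorted A → x ∉ delete x A
∉-delete x (z ∷ A) s x∈ with x ≟ z
∉-delete x (z ∷ A) s x∈         | yes refl = <-irrefl refl (All.lookup (head<tail s) x∈)
∉-delete x (z ∷ A) s (here x≡z) | no  x≢z  = x≢z x≡z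
∉-delete x (z ∷ A) s (there x∈) | no  _    = ∉-delete x A (Linked.tail s) x∈

length-delete : ∀ {x} A → x ∈ A → length A ≡ suc (length (delete x A))
length-delete {x} (z ∷ A) x∈ with x ≟ z
length-delete (z ∷ A) x∈          | yes _   = refl
length-delete (z ∷ A) (here x≡z)  | no  x≢z = contradiction x≡z x≢z
length-delete (z ∷ A) (there x∈)  | no  _   = cong suc (length-delete A x∈)

rank : List ℕ → ℕ → ℕ
rank []      t = 0
rank (a ∷ A) t with a ≤? t
... | yes _ = suc (rank A t)
... | no  _ = rank A t

rank-∷-≤ : ∀ {a t} A → a ≤ t → rank (a ∷ A) t ≡ suc (rank A t)
rank-∷-≤ {a} {t} A a≤t with a ≤? t
... | yes _   = refl
... | no  a≰t = contradiction a≤t a≰t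

rank-∷-> : ∀ {a t} A → t < a → rank (a ∷ A) t ≡ rank A t
rank-∷-> {a} {t} A t<a with a ≤? t
... | yes a≤t = contradiction a≤t (<⇒≱ t<a)
... | no  _   = refl

rank-none : ∀ {t} A → All (t <_) A → rank A t ≡ 0
rank-none []      []           = refl
rank-none (a ∷ A) (t<a ∷ t<A) = trans (rank-∷-> A t<a) (rank-none A t<A)

rank-all : ∀ {t} A → All (_≤ t) A → rank A t ≡ length A
rank-all []      []           = refl
rank-all (a ∷ A) (a≤t ∷ A≤t) = trans (rank-∷-≤ A a≤t) (cong suc (rank-all A A≤t))

rank-suc-∈ : ∀ {t} A → Sorted A → suc t ∈ A → rank A (suc t) ≡ suc (rank A t)
rank-suc-∈ {t} (_ ∷ A) s (here refl) = begin
  rank (suc t ∷ A) (suc t)  ≡⟨ rank-∷-≤ A (≤-refl {suc t}) ⟩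
  suc (rank A (suc t))      ≡⟨ cong suc (rank-none A (head<tail s)) ⟩
  1                         ≡⟨ cong suc (rank-none A (All.map (<-trans (n<1+n t)) (head<tail s))) ⟨
  suc (rank A t)            ≡⟨ cong suc (rank-∷-> A (n<1+n t)) ⟨
  suc (rank (suc t ∷ A) t)  ∎
  where open ≡-Reasoning
rank-suc-∈ {t} (a ∷ A) s (there t+1∈A) = begin
  rank (a ∷ A) (suc t)  ≡⟨ rank-∷-≤ A (<⇒≤ a<t+1) ⟩
  suc (rank A (suc t))  ≡⟨ cong suc (rank-suc-∈ A (Linked.tail s) t+1∈A) ⟩
  suc (suc (rank A t))  ≡⟨ cong suc (rank-∷-≤ A (s≤s⁻¹ a<t+1)) ⟨
  suc (rank (a ∷ A) t)  ∎
  where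
  open ≡-Reasoning
  a<t+1 : a < suc t
  a<t+1 = All.lookup (head<tail s) t+1∈A

rank-suc-∉ : ∀ {t} A → suc t ∉ A → rank A (suc t) ≡ rank A t
rank-suc-∉ []          _ = refl
rank-suc-∉ {t} (a ∷ A) t+1∉ with a ≤? t
... | yes a≤t = trans (rank-∷-≤ A (m≤n⇒m≤1+n a≤t)) (cong suc (rank-suc-∉ A (t+1∉ ∘ there)))
... | no  a≰t = trans (rank-∷-> A t+1<a) (rank-suc-∉ A (t+1∉ ∘ there))
  where
  t+1<a : suc t < a
  t+1<a = ≤∧≢⇒< (≰⇒> a≰t) (t+1∉ ∘ here)

rank-∷-cong : ∀ {t} a A B → rank A t ≡ rank B t → rank (a ∷ A) t ≡ rank (a ∷ B) t
rank-∷-cong {t} a _ _ eq with a ≤? t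
... | yes _ = cong suc eq
... | no  _ = eq

rank-delete : ∀ {t x} A → t < x → rank (delete x A) t ≡ rank A t
rank-delete     []      _   = refl
rank-delete {x = x} (a ∷ A) t<x with x ≟ a
... | yes refl = sym (rank-∷-> A t<x)
... | no  _    = rank-∷-cong a (delete x A) A (rank-delete A t<x)

IsAt⇒∈ : ∀ {A i x} → IsAt A i x → x ∈ A
IsAt⇒∈ here      = here refl
IsAt⇒∈ (there p) = there (IsAt⇒∈ p)

∈⇒IsAt : ∀ {A x} → x ∈ A → ∃ λ i → IsAt A i x
∈⇒IsAt (here refl) = zero , here
∈⇒IsAt (there x∈A) with i , at ← ∈⇒IsAt x∈A = suc i , there at

IsAt⇒rank : ∀ {A i x} → Sorted A → IsAt A i x → rank A x ≡ suc i
IsAt⇒rank {x ∷ A} s here =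
  trans (rank-∷-≤ A ≤-refl) (cong suc (rank-none A (head<tail s)))
IsAt⇒rank {a ∷ A} s (there at) =
  trans (rank-∷-≤ A (<⇒≤ (All.lookup (head<tail s) (IsAt⇒∈ at))))
        (cong suc (IsAt⇒rank (Linked.tail s) at))

Pointwise⇒rank-≥ : ∀ {U L} → Pointwise _≤_ U L → ∀ t → rank L t ≤ rank U t
Pointwise⇒rank-≥ []                      t = z≤n
Pointwise⇒rank-≥ {u ∷ U} {l ∷ L} (u≤l ∷ U≤L) t with u ≤? t | l ≤? t
... | yes _   | yes _   = s≤s (Pointwise⇒rank-≥ U≤L t)
... | yes _   | no  _   = m≤n⇒m≤1+n (Pointwise⇒rank-≥ U≤L t)
... | no  u≰t | yes l≤t = contradiction (≤-trans u≤l l≤t) u≰t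
... | no  _   | no  _   = Pointwise⇒rank-≥ U≤L t

rank-≥⇒Pointwise : ∀ {U L} → Sorted U → Sorted L → length U ≡ length L →
                   (∀ t → rank L t ≤ rank U t) → Pointwise _≤_ U L
rank-≥⇒Pointwise {[]}    {[]}    _  _  _  _     = []
rank-≥⇒Pointwise {u ∷ U} {l ∷ L} sU sL eq ranks =
  u≤l ∷ rank-≥⇒Pointwise (Linked.tail sU) (Linked.tail sL) (suc-injective eq) tail-ranks
  where
  u≤l : u ≤ l
  u≤l with u ≤? l
  ... | yes u≤l = u≤l
  ... | no  u≰l = contradiction (subst₂ _≤_ (rank-∷-≤ L (≤-refl {l})) rank-l (ranks l)) λ ()
    where
    l<u : l < u
    l<u = ≰⇒> u≰l
    rank-l : rank (u ∷ U) l ≡ 0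
    rank-l = rank-none (u ∷ U) (l<u ∷ All.map (<-trans l<u) (head<tail sU))
  tail-ranks : ∀ t → rank L t ≤ rank U t
  tail-ranks t with l ≤? t
  ... | yes l≤t = s≤s⁻¹ (subst₂ _≤_ (rank-∷-≤ L l≤t) (rank-∷-≤ U (≤-trans u≤l l≤t)) (ranks t))
  ... | no  l≰t =
    subst (_≤ rank U t) (sym (rank-none L (All.map (<-trans (≰⇒> l≰t)) (head<tail sL)))) z≤n

range-sorted : ∀ n → Sorted (range n)
range-sorted n = map⁺ (applyUpTo⁺₂ (λ i → i) n (λ i → n<1+n (suc i)))

∈-range⁻ : ∀ {n y} → y ∈ range n → InRange n y
∈-range⁻ y∈ with i , i∈ , refl ← ∈-map⁻ suc y∈ = s≤s z≤n , ∈-upTo⁻ i∈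

∈-range⁺ : ∀ {n y} → InRange n y → y ∈ range n
∈-range⁺ {y = suc i} (_ , i<n) = ∈-map⁺ suc (∈-upTo⁺ i<n)

mirror-InRange : ∀ {n x} → InRange n x → InRange n (suc n ∸ x)
mirror-InRange {n} {suc p} (_ , x≤n) = subst (1 ≤_) (sym (+-∸-assoc 1 x≤n)) (s≤s z≤n) , m∸n≤m n p

mirror-involutive : ∀ {n x} → InRange n x → suc n ∸ (suc n ∸ x) ≡ x
mirror-involutive (_ , x≤n) = m∸[m∸n]≡n (m≤n⇒m≤1+n x≤n)

mirror∉? : ∀ n A → Decidable (λ y → suc n ∸ y ∉ A)
mirror∉? n A y = ¬? (suc n ∸ y ∈? A)

-- Opaque, so that unification sees reverseComplement n A and can infer n and A.
opaque
  reverseComplement : ℕ → List ℕ → List ℕ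
  reverseComplement n A = filter (mirror∉? n A) (range n)

  ∈-reverseComplement⁻ : ∀ {n A y} → y ∈ reverseComplement n A → InRange n y × suc n ∸ y ∉ A
  ∈-reverseComplement⁻ {n} {A} y∈ with y∈range , mirror∉A ← ∈-filter⁻ (mirror∉? n A) y∈ =
    ∈-range⁻ y∈range , mirror∉A

  ∈-reverseComplement⁺ : ∀ {n A y} → InRange n y → suc n ∸ y ∉ A → y ∈ reverseComplement n A
  ∈-reverseComplement⁺ {n} {A} y∈[n] = ∈-filter⁺ (mirror∉? n A) (∈-range⁺ y∈[n])

  reverseComplement-sorted : ∀ {n A} → Sorted (reverseComplement n A)
  reverseComplement-sorted {n} {A} = filter⁺ (mirror∉? n A) <-trans (range-sorted n)

  reverseComplement-[] : ∀ n → reverseComplement n [] ≡ range n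
  reverseComplement-[] n = filter-all (mirror∉? n []) (All.universal (λ _ ()) (range n))

  reverseComplement-range : ∀ n → reverseComplement n (range n) ≡ []
  reverseComplement-range n = filter-none (mirror∉? n (range n))
    (All.tabulate (λ y∈ y*∉ → y*∉ (∈-range⁺ (mirror-InRange (∈-range⁻ y∈)))))

reverseComplement-InRange : ∀ {n A} → All (InRange n) (reverseComplement n A)
reverseComplement-InRange = All.tabulate (proj₁ ∘ ∈-reverseComplement⁻)

module _ {n : ℕ} {A : List ℕ} where

  rank-reverseComplement : Sorted A → All (InRange n) A → ∀ t s → t + s ≡ n →
    rank (reverseComplement n A) t + length A ≡ t + rank A s
  rank-reverseComplement sA A⊆[n] zero s refl = cong₂ _+_
    (rank-none _ (All.map proj₁ reverseComplement-InRange))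
    (sym (rank-all A (All.map proj₂ A⊆[n])))
  rank-reverseComplement sA A⊆[n] (suc t) s t+1+s≡n = step (suc s ∈? A)
    where
    open ≡-Reasoning
    RA = reverseComplement n A
    t+[s+1]≡n : t + suc s ≡ n
    t+[s+1]≡n = trans (+-suc t s) t+1+s≡n
    ih : rank RA t + length A ≡ t + rank A (suc s)
    ih = rank-reverseComplement sA A⊆[n] t (suc s) t+[s+1]≡n
    mirror : suc n ∸ suc t ≡ suc s
    mirror = subst (λ m → m ∸ t ≡ suc s) t+[s+1]≡n (m+n∸m≡n t (suc s))
    step : Dec (suc s ∈ A) → rank RA (suc t) + length A ≡ suc t + rank A s
    step (yes s+1∈A) = begin
      rank RA (suc t) + length A  ≡⟨ cong (_+ length A) (rank-suc-∉ RA t+1∉RA) ⟩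
      rank RA t + length A        ≡⟨ ih ⟩
      t + rank A (suc s)          ≡⟨ cong (t +_) (rank-suc-∈ A sA s+1∈A) ⟩
      t + suc (rank A s)          ≡⟨ +-suc t (rank A s) ⟩
      suc t + rank A s            ∎
      where
      t+1∉RA : suc t ∉ RA
      t+1∉RA t+1∈RA = subst (_∉ A) mirror (proj₂ (∈-reverseComplement⁻ t+1∈RA)) s+1∈A
    step (no s+1∉A) = begin
      rank RA (suc t) + length A  ≡⟨ cong (_+ length A) (rank-suc-∈ RA reverseComplement-sorted t+1∈RA) ⟩
      suc (rank RA t + length A)  ≡⟨ cong suc ih ⟩
      suc (t + rank A (suc s))    ≡⟨ cong (suc ∘ (t +_)) (rank-suc-∉ A s+1∉A) ⟩
      suc t + rank A s            ∎
      where
      t+1∈RA : suc t ∈ RA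
      t+1∈RA = ∈-reverseComplement⁺ (s≤s z≤n , subst (suc t ≤_) t+1+s≡n (m≤m+n (suc t) s))
                                    (subst (_∉ A) (sym mirror) s+1∉A)

  length-reverseComplement : Sorted A → All (InRange n) A → length (reverseComplement n A) + length A ≡ n
  length-reverseComplement sA A⊆[n] = begin
    length RA + length A  ≡⟨ cong (_+ length A) (rank-all RA (All.map proj₂ reverseComplement-InRange)) ⟨
    rank RA n + length A  ≡⟨ rank-reverseComplement sA A⊆[n] n 0 (+-identityʳ n) ⟩
    n + rank A 0          ≡⟨ cong (n +_) (rank-none A (All.map proj₁ A⊆[n])) ⟩
    n + 0                 ≡⟨ +-identityʳ n ⟩
    n                     ∎
    where
    open ≡-Reasoning
    RA = reverseComplement n A

reverseComplement-delete : ∀ {n A} → Sorted A → ∀ {x} → x ∈ A → InRange n x →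
  reverseComplement n A ≡ delete (suc n ∸ x) (reverseComplement n (delete x A))
reverseComplement-delete {n} {A} sA {x} x∈A x∈[n] =
  sorted-ext reverseComplement-sorted (delete-sorted x* _ reverseComplement-sorted) ⊆ ⊇
  where
  x* = suc n ∸ x
  ⊆ : ∀ {y} → y ∈ reverseComplement n A → y ∈ delete x* (reverseComplement n (delete x A))
  ⊆ {y} y∈ with y∈[n] , y*∉A ← ∈-reverseComplement⁻ y∈ =
    ∈-delete⁺ x* _ (∈-reverseComplement⁺ y∈[n] (y*∉A ∘ ∈-delete⁻ x A)) y≢x*
    where
    y≢x* : y ≢ x*
    y≢x* refl = y*∉A (subst (_∈ A) (sym (mirror-involutive x∈[n])) x∈A)
  ⊇ : ∀ {y} → y ∈ delete x* (reverseComplement n (delete x A)) → y ∈ reverseComplement n A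
  ⊇ {y} y∈ with y∈[n] , y*∉A∖x ← ∈-reverseComplement⁻ (∈-delete⁻ x* _ y∈) =
    ∈-reverseComplement⁺ y∈[n] y*∉A
    where
    y*∉A : suc n ∸ y ∉ A
    y*∉A y*∈A with suc n ∸ y ≟ x
    ... | yes y*≡x = ∉-delete x* _ reverseComplement-sorted
                       (subst (_∈ _) (trans (sym (mirror-involutive y∈[n])) (cong (suc n ∸_) y*≡x)) y∈)
    ... | no  y*≢x = y*∉A∖x (∈-delete⁺ x A y*∈A y*≢x)

reverseComplement-Pointwise : ∀ {n U L} → Sorted U → Sorted L → All (InRange n) U → All (InRange n) L →
  Pointwise _≤_ U L → Pointwise _≤_ (reverseComplement n U) (reverseComplement n L)
reverseComplement-Pointwise {n} {U} {L} sU sL U⊆[n] L⊆[n] U≤L =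
  rank-≥⇒Pointwise reverseComplement-sorted reverseComplement-sorted lengths ranks
  where
  RU = reverseComplement n U
  RL = reverseComplement n L
  |U|≡|L| : length U ≡ length L
  |U|≡|L| = Pointwise-length U≤L
  lengths : length RU ≡ length RL
  lengths = +-cancelʳ-≡ (length U) _ _ (trans (length-reverseComplement sU U⊆[n])
    (sym (trans (cong (length RL +_) |U|≡|L|) (length-reverseComplement sL L⊆[n]))))
  ranks : ∀ t → rank RL t ≤ rank RU t
  ranks t with ≤-total t n
  ... | inj₁ t≤n = +-cancelʳ-≤ (length U) _ _ (begin
    rank RL t + length U  ≡⟨ cong (rank RL t +_) |U|≡|L| ⟩
    rank RL t + length L  ≡⟨ rank-reverseComplement sL L⊆[n] t (n ∸ t) (m+[n∸m]≡n t≤n) ⟩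
    t + rank L (n ∸ t)    ≤⟨ +-monoʳ-≤ t (Pointwise⇒rank-≥ U≤L (n ∸ t)) ⟩
    t + rank U (n ∸ t)    ≡⟨ rank-reverseComplement sU U⊆[n] t (n ∸ t) (m+[n∸m]≡n t≤n) ⟨
    rank RU t + length U  ∎)
    where open ≤-Reasoning
  ... | inj₂ n≤t = ≤-reflexive (begin
    rank RL t  ≡⟨ rank-all RL below-t ⟩
    length RL  ≡⟨ lengths ⟨
    length RU  ≡⟨ rank-all RU below-t ⟨
    rank RU t  ∎)
    where
    open ≡-Reasoning
    below-t : ∀ {A} → All (_≤ t) (reverseComplement n A)
    below-t = All.map (λ (_ , y≤n) → ≤-trans y≤n n≤t) reverseComplement-InRange

IsAt-reverseComplement-delete : ∀ {n A i x} → Sorted A → All (InRange n) A → IsAt A i x →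
  Σ[ k ∈ ℕ ] IsAt (reverseComplement n (delete x A)) k (suc n ∸ x) × k + length A ≡ (suc n ∸ x) + i
IsAt-reverseComplement-delete {x = zero} _ A⊆[n] x-at-i
  with () ← proj₁ (All.lookup A⊆[n] (IsAt⇒∈ x-at-i))
IsAt-reverseComplement-delete {n} {A} {i} {suc p} sA A⊆[n] x-at-i = k , y-at-k , position
  where
  open ≡-Reasoning
  x∈A = IsAt⇒∈ x-at-i
  x∈[n] = All.lookup A⊆[n] x∈A
  B = delete (suc p) A
  y = n ∸ p
  y∈RB : y ∈ reverseComplement n B
  y∈RB = ∈-reverseComplement⁺ (mirror-InRange x∈[n])
           (∉-delete (suc p) A sA ∘ subst (_∈ B) (mirror-involutive x∈[n]))
  k = proj₁ (∈⇒IsAt y∈RB)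
  y-at-k = proj₂ (∈⇒IsAt y∈RB)
  rank-p : rank A p ≡ i
  rank-p = suc-injective (trans (sym (rank-suc-∈ A sA x∈A)) (IsAt⇒rank sA x-at-i))
  position : k + length A ≡ y + i
  position = begin
    k + length A                         ≡⟨ cong (k +_) (length-delete A x∈A) ⟩
    k + suc (length B)                   ≡⟨ +-suc k (length B) ⟩
    suc k + length B                     ≡⟨ cong (_+ length B) (IsAt⇒rank reverseComplement-sorted y-at-k) ⟨
    rank (reverseComplement n B) y + length B
      ≡⟨ rank-reverseComplement (delete-sorted (suc p) A sA) (All-delete (suc p) A A⊆[n]) y p
                                (m∸n+n≡m (<⇒≤ (proj₂ x∈[n]))) ⟩
    y + rank B p                         ≡⟨ cong (y +_) (rank-delete A (n<1+n p)) ⟩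
    y + rank A p                         ≡⟨ cong (y +_) rank-p ⟩
    y + i                                ∎

mirror-≤ : ∀ {a b a* b* c d} → a* + a ≡ b* + b → b + c ≤ a + d → a* + c ≤ b* + d
mirror-≤ {a} {b} {a*} {b*} {c} {d} mirror b+c≤a+d = +-cancelʳ-≤ (a + b) _ _ (begin
  (a* + c) + (a + b)  ≡⟨ interchange a* c a b ⟩
  (a* + a) + (c + b)  ≡⟨ cong₂ _+_ mirror (+-comm c b) ⟩
  (b* + b) + (b + c)  ≤⟨ +-monoʳ-≤ (b* + b) b+c≤a+d ⟩
  (b* + b) + (a + d)  ≡⟨ cong ((b* + b) +_) (+-comm a d) ⟩
  (b* + b) + (d + a)  ≡⟨ interchange b* d b a ⟨
  (b* + d) + (b + a)  ≡⟨ cong ((b* + d) +_) (+-comm b a) ⟩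
  (b* + d) + (a + b)  ∎)
  where open ≤-Reasoning

mirror-GoodPositions : ∀ {ℓ u ℓ* u* i j i* j* K} → ℓ* + ℓ ≡ u* + u →
  i* + K ≡ ℓ* + i → j* + K ≡ u* + j →
  i ≤ j → u + i ≤ ℓ + j → i* ≤ j* × u* + i* ≤ ℓ* + j*
mirror-GoodPositions {ℓ} {u} {ℓ*} {u*} {i} {j} {i*} {j*} {K} mirror ℓ-pos u-pos i≤j u+i≤ℓ+j =
  +-cancelʳ-≤ K _ _ (begin
    i* + K  ≡⟨ ℓ-pos ⟩
    ℓ* + i  ≤⟨ mirror-≤ {ℓ} {u} {ℓ*} {u*} mirror u+i≤ℓ+j ⟩
    u* + j  ≡⟨ u-pos ⟨
    j* + K  ∎)
  , +-cancelʳ-≤ K _ _ (begin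
    (u* + i*) + K  ≡⟨ +-assoc u* i* K ⟩
    u* + (i* + K)  ≡⟨ cong (u* +_) ℓ-pos ⟩
    u* + (ℓ* + i)  ≤⟨ +-monoʳ-≤ u* (+-monoʳ-≤ ℓ* i≤j) ⟩
    u* + (ℓ* + j)  ≡⟨ x∙yz≈y∙xz u* ℓ* j ⟩
    ℓ* + (u* + j)  ≡⟨ cong (ℓ* +_) u-pos ⟨
    ℓ* + (j* + K)  ≡⟨ +-assoc ℓ* j* K ⟨
    (ℓ* + j*) + K  ∎)
  where open ≤-Reasoning

reversedDual : ∀ {n} → LPM n → LPM n
reversedDual {n} M = record
  { U        = reverseComplement n (U M)
  ; L        = reverseComplement n (L M)
  ; U-sorted = reverseComplement-sorted
  ; L-sorted = reverseComplement-sorted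
  ; U-range  = reverseComplement-InRange
  ; L-range  = reverseComplement-InRange
  ; U≤L      = reverseComplement-Pointwise (U-sorted M) (L-sorted M) (U-range M) (L-range M) (U≤L M)
  }

Cover-reversedDual : ∀ {n} {M M′ : LPM n} {lab} → Cover M M′ lab →
                     Cover (reversedDual M′) (reversedDual M) (flipLabel n lab)
Cover-reversedDual {n} {M} {M′} {ℓ , u} ((i , j , ℓ-at-i , u-at-j , i≤j , u+i≤ℓ+j) , U≡ , L≡)
  with i* , ℓ*-at-i* , ℓ*-pos ← IsAt-reverseComplement-delete (L-sorted M′) (L-range M′) ℓ-at-i
     | j* , u*-at-j* , u*-pos ← IsAt-reverseComplement-delete (U-sorted M′) (U-range M′) u-at-j
  rewrite U≡ | L≡ =
    ( i* , j* , ℓ*-at-i* , u*-at-j*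
    , mirror-GoodPositions mirror ℓ*-pos (subst (λ K → j* + K ≡ _) |U′|≡|L′| u*-pos) i≤j u+i≤ℓ+j )
  , reverseComplement-delete (U-sorted M′) (IsAt⇒∈ u-at-j) u∈[n]
  , reverseComplement-delete (L-sorted M′) (IsAt⇒∈ ℓ-at-i) ℓ∈[n]
  where
  ℓ∈[n] = All.lookup (L-range M′) (IsAt⇒∈ ℓ-at-i)
  u∈[n] = All.lookup (U-range M′) (IsAt⇒∈ u-at-j)
  |U′|≡|L′| = Pointwise-length (U≤L M′)
  mirror : (suc n ∸ ℓ) + ℓ ≡ (suc n ∸ u) + u
  mirror = trans (m∸n+n≡m (m≤n⇒m≤1+n (proj₂ ℓ∈[n])))
                 (sym (m∸n+n≡m (m≤n⇒m≤1+n (proj₂ u∈[n]))))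

ChainTo : ∀ {n} → LPM n → List Label → List ℕ → List ℕ → Set
ChainTo M []           U′ L′ = U M ≡ U′ × L M ≡ L′
ChainTo M (lab ∷ labs) U′ L′ = Σ[ M′ ∈ LPM _ ] (Cover M M′ lab × ChainTo M′ labs U′ L′)

ChainToTop⇒ChainTo : ∀ {n} M labs → ChainToTop n M labs → ChainTo M labs (range n) (range n)
ChainToTop⇒ChainTo M []           top              = top
ChainToTop⇒ChainTo M (lab ∷ labs) (M′ , c , chain) = M′ , c , ChainToTop⇒ChainTo M′ labs chain

ChainTo⇒ChainToTop : ∀ {n} M labs → ChainTo M labs (range n) (range n) → ChainToTop n M labs
ChainTo⇒ChainToTop M []           top              = top
ChainTo⇒ChainToTop M (lab ∷ labs) (M′ , c , chain) = M′ , c , ChainTo⇒ChainToTop M′ labs chain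

ChainTo-∷ʳ : ∀ {n} {M : LPM n} T T′ labs {lab} →
             ChainTo M labs (U T) (L T) → Cover T T′ lab → ChainTo M (labs ∷ʳ lab) (U T′) (L T′)
ChainTo-∷ʳ _ T′ [] (U≡ , L≡) (good , U-cover , L-cover) =
  T′ , (good , trans U≡ U-cover , trans L≡ L-cover) , refl , refl
ChainTo-∷ʳ T T′ (_ ∷ labs) (M′ , c , chain) cover = M′ , c , ChainTo-∷ʳ T T′ labs chain cover

ChainTo-reversedDual : ∀ {n} (M T : LPM n) labs → ChainTo M labs (U T) (L T) →
  ChainTo (reversedDual T) (reflect n labs) (reverseComplement n (U M)) (reverseComplement n (L M))
ChainTo-reversedDual M T [] (U≡ , L≡) =
  cong (reverseComplement _) (sym U≡) , cong (reverseComplement _) (sym L≡)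
ChainTo-reversedDual {n} M T (lab ∷ labs) (M′ , cover , chain) =
  subst (λ labs* → ChainTo (reversedDual T) labs* _ _)
        (sym (unfold-reverse (flipLabel n lab) (map (flipLabel n) labs)))
        (ChainTo-∷ʳ (reversedDual M′) (reversedDual M) (reflect n labs)
                    (ChainTo-reversedDual M′ T labs chain)
                    (Cover-reversedDual {M = M} {M′} {lab} cover))

Linked-reverseAcc : ∀ {A : Set} {R : A → A → Set} {x xs acc} →
  Linked R (x ∷ xs) → Linked (flip R) (x ∷ acc) → Linked (flip R) (reverseAcc acc (x ∷ xs))
Linked-reverseAcc {xs = []}    _               racc = racc
Linked-reverseAcc {xs = _ ∷ _} (Rxy ∷ linked) racc = Linked-reverseAcc linked (Rxy ∷ racc)

Linked-reverse : ∀ {A : Set} {R : A → A → Set} {xs} → Linked R xs → Linked (flip R) (reverse xs)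
Linked-reverse {xs = []}    _      = []
Linked-reverse {xs = _ ∷ _} linked = Linked-reverseAcc linked [-]

flipLabel-NotAscent : ∀ n {a b} → NotAscent a b → NotAscent (flipLabel n b) (flipLabel n a)
flipLabel-NotAscent n {_ , _} {_ , _} notAscent (ℓ*<ℓ′* , u*<u′*) =
  notAscent (∸-cancelʳ-< ℓ*<ℓ′* , ∸-cancelʳ-< u*<u′*)

Falling-reflect : ∀ n {labs} → Falling labs → Falling (reflect n labs)
Falling-reflect n = Linked-reverse ∘ map⁺ ∘ Linked.map (flipLabel-NotAscent n)

freeLPM : ∀ n → LPM n
freeLPM n = record
  { U        = range n
  ; L        = range n
  ; U-sorted = range-sorted n
  ; L-sorted = range-sorted n
  ; U-range  = All.tabulate ∈-range⁻
  ; L-range  = All.tabulate ∈-range⁻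
  ; U≤L      = Pointwise.refl ≤-refl
  }

lemma3p8 : (n : ℕ) → 1 ≤ n → (labs : List Label) →
    IsFallingMaxChainLabels n labs →
    IsFallingMaxChainLabels n (reflect n labs)
lemma3p8 n _ labs ((M₀ , U₀≡[] , L₀≡[] , chain) , falling) =
  ( reversedDual (freeLPM n)
  , reverseComplement-range n
  , reverseComplement-range n
  , ChainTo⇒ChainToTop _ (reflect n labs) reflected )
  , Falling-reflect n falling
  where
  bottom* : ∀ {A} → A ≡ [] → reverseComplement n A ≡ range n
  bottom* A≡[] = trans (cong (reverseComplement n) A≡[]) (reverseComplement-[] n)
  reflected : ChainTo (reversedDual (freeLPM n)) (reflect n labs) (range n) (range n)
  reflected = subst₂ (ChainTo _ _) (bottom* U₀≡[]) (bottom* L₀≡[])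
    (ChainTo-reversedDual M₀ (freeLPM n) labs (ChainToTop⇒ChainTo M₀ labs chain))
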